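{- Let $\mathbb{I}$ be the icosahedron graph. Then $k(\mathbb{I})=4$.
   Context: All graphs are simple and undirected. The icosahedron graph $\mathbb{I}$ is the graph formed by the $12$ vertices and $30$ edges of a regular icosahedron (a $5$-regular planar graph all of whose faces are triangles). The competition graph $C(D)$ of a digraph $D$ is the graph with vertex set $V(D)$ in which two distinct vertices $x,y$ are adjacent if and only if there is a vertex $v$ with $(x,v)$ and $(y,v)$ both arcs of $D$. The competition number $k(G)$ of a graph $G$ is the minimum integer $k\ge 0$ such that $G$ together with $k$ new isolated vertices is the competition graph of some acyclic digraph. -}

module Defs where

open import Data.Nat using (ℕ; _+_; _≤_; _≡ᵇ_)
open import Data.Bool using (Bool; true; false; _∧_; _∨_; T)
open import Data.Fin using (Fin; toℕ; _↑ˡ_; splitAt)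
open import Data.Sum using (inj₁; inj₂)
open import Data.Product using (_×_; _,_; ∃-syntax)
open import Data.List using (List; []; _∷_)
open import Data.Bool.ListAction using (any)
open import Relation.Binary.PropositionalEquality using (_≢_)
open import Relation.Binary.Construct.Closure.Transitive using (TransClosure)
open import Relation.Nullary using (¬_)
open import Function.Bundles using (_⇔_)

-- A simple graph on vertex set Fin n, given by a Boolean adjacency function
-- (only its values on distinct pairs matter; symmetry/irreflexivity are
-- part of the concrete graphs below).
Graph : ℕ → Set
Graph n = Fin n → Fin n → Bool

Digraph : ℕ → Set
Digraph n = Fin n → Fin n → Bool

Arc : ∀ {n} → Digraph n → Fin n → Fin n → Set
Arc D x y = T (D x y)

Acyclic : ∀ {n} → Digraph n → Set
Acyclic {n} D = ∀ (v : Fin n) → ¬ TransClosure (Arc D) v v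

IsCompetitionGraphOf : ∀ {n} → Graph n → Digraph n → Set
IsCompetitionGraphOf {n} G D =
  ∀ (x y : Fin n) → x ≢ y → (T (G x y) ⇔ (∃[ v ] (Arc D x v × Arc D y v)))

-- G together with k new isolated vertices (vertices of G are i ↑ˡ k,
-- the new vertices are n ↑ʳ j).
addIsolated : ∀ {n} → Graph n → (k : ℕ) → Graph (n + k)
addIsolated {n} G k x y with splitAt n x | splitAt n y
... | inj₁ i | inj₁ j = G i j
... | _      | _      = false

CompetitionRepresentable : ∀ {n} → Graph n → ℕ → Set
CompetitionRepresentable {n} G k =
  ∃[ D ] (Acyclic {n + k} D × IsCompetitionGraphOf (addIsolated G k) D)

CompetitionNumberIs : ∀ {n} → Graph n → ℕ → Set
CompetitionNumberIs G m =
  CompetitionRepresentable G m × (∀ k → CompetitionRepresentable G k → m ≤ k)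

-- The icosahedron graph on Fin 12: 0 top, 1..5 upper pentagon,
-- 6..10 lower pentagon, 11 bottom.
icosaEdges : List (ℕ × ℕ)
icosaEdges =
  (0 , 1) ∷ (0 , 2) ∷ (0 , 3) ∷ (0 , 4) ∷ (0 , 5) ∷
  (1 , 2) ∷ (2 , 3) ∷ (3 , 4) ∷ (4 , 5) ∷ (5 , 1) ∷
  (1 , 6) ∷ (1 , 7) ∷ (2 , 7) ∷ (2 , 8) ∷ (3 , 8) ∷
  (3 , 9) ∷ (4 , 9) ∷ (4 , 10) ∷ (5 , 10) ∷ (5 , 6) ∷
  (6 , 7) ∷ (7 , 8) ∷ (8 , 9) ∷ (9 , 10) ∷ (10 , 6) ∷
  (11 , 6) ∷ (11 , 7) ∷ (11 , 8) ∷ (11 , 9) ∷ (11 , 10) ∷ []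

icosahedron : Graph 12
icosahedron x y = any match icosaEdges
  where
  a = toℕ x
  b = toℕ y
  match : ℕ × ℕ → Bool
  match (p , q) = ((p ≡ᵇ a) ∧ (q ≡ᵇ b)) ∨ ((p ≡ᵇ b) ∧ (q ≡ᵇ a))

-- The lower bound uses only that the icosahedron is K₄-free, that every vertex has five neighbours,
-- and that every edge xy has two common neighbours a, b, two neighbours p, q of x outside N[y] and
-- two neighbours c, d of y outside N[x].  In a competition graph every in-neighbourhood is a clique
-- and every edge lies in one.
--
-- Upper bound: four isolated vertices suffice, by an explicit acyclic digraph.
--
-- Lower bound: suppose k ≤ 3 isolated vertices suffice.  By acyclicity choose icosahedron vertices
-- x, y, z in turn, each with no arc to icosahedron vertices except the ones chosen before it.  The five
-- edges at x are then covered by the k cliques of the new vertices, and a clique through x holds at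
-- most two neighbours of x (K₄-freeness), so every one of those k ≤ 3 cliques passes through x.  The
-- edges at y can use only these cliques and the in-neighbourhood Bx of x.  If x ≁ y, Bx alone would
-- have to cover all five.  If x ∼ y, the cliques are forced to be the triangles xya, xyb, xpq and Bx ⊇ ycd;
-- z lies in at most one of these four triangles, so the in-neighbourhood of y must contain z together
-- with three of its neighbours: a K₄.

module Submission where

open import Defs

open import Level using (0ℓ)
open import Data.Nat as ℕ using (ℕ; zero; suc; _+_; _≡ᵇ_; _≤′_; ≤′-reflexive; ≤′-step; s≤s)
import Data.Nat.Properties as ℕₚ
open import Data.Bool using (T; if_then_else_)
open import Data.Bool.Properties using (T?)
open import Data.Bool.ListAction using (any)
open import Data.Fin using (Fin; toℕ; #_; _<_; inject≤; punchOut; _↑ˡ_; _↑ʳ_; splitAt)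
open import Data.Fin.Properties
  using (_≟_; all?; any?; _<?_; <⇒≢; <-trans; inject≤-injective; punchOut-injective; pigeonhole;
         splitAt-↑ˡ; splitAt⁻¹-↑ˡ; splitAt⁻¹-↑ʳ; ↑ˡ-injective)
open import Data.Fin.Patterns using (0F; 1F; 2F; 3F; 4F)
open import Data.List using (List; []; _∷_)
open import Data.Vec using (Vec; []; _∷_; lookup; tabulate)
open import Data.Vec.Properties using (lookup∘tabulate)
open import Data.Product using (Σ; _×_; _,_; ∃-syntax; proj₁; proj₂; uncurry)
open import Data.Sum using (_⊎_; inj₁; inj₂)
import Data.Sum as Sum
open import Data.Unit using (⊤; tt)
open import Data.Empty using (⊥; ⊥-elim)
open import Function using (_∘_)
open import Function.Bundles using (_⇔_; mk⇔; Equivalence)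
open import Relation.Binary using (Rel; Decidable)
open import Relation.Binary.Construct.Closure.Transitive using (TransClosure; [_]; _∷_; _∷ʳ_)
open import Relation.Binary.PropositionalEquality using (_≡_; _≢_; refl; sym; trans; subst)
open import Relation.Nullary using (¬_; Dec; yes; no; does)
open import Relation.Nullary.Decidable
  using (toWitness; map′; dec-true; dec-false; decidable-stable; _×-dec_; _→-dec_; _⊎-dec_; ¬?)
open import Relation.Unary using (Pred) renaming (Decidable to Decidable₁)

-- Pigeonhole on five points

Collision₃ : ∀ {A : Set} → (Fin 5 → A) → Set
Collision₃ f = ∃[ t₁ ] ∃[ t₂ ] ∃[ t₃ ] (t₁ < t₂ × t₂ < t₃ × f t₁ ≡ f t₂ × f t₂ ≡ f t₃)

collision₃-reflect : ∀ {A B : Set} {f : Fin 5 → A} {g : Fin 5 → B} →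
                     (∀ t t′ → g t ≡ g t′ → f t ≡ f t′) → Collision₃ g → Collision₃ f
collision₃-reflect g⇒f (t₁ , t₂ , t₃ , t₁<t₂ , t₂<t₃ , e₁₂ , e₂₃) =
  t₁ , t₂ , t₃ , t₁<t₂ , t₂<t₃ , g⇒f t₁ t₂ e₁₂ , g⇒f t₂ t₃ e₂₃

collision₃? : ∀ {k} (f : Fin 5 → Fin k) → Dec (Collision₃ f)
collision₃? f = any? λ t₁ → any? λ t₂ → any? λ t₃ →
  t₁ <? t₂ ×-dec t₂ <? t₃ ×-dec f t₁ ≟ f t₂ ×-dec f t₂ ≟ f t₃

collision₃-Fin2 : (f : Fin 5 → Fin 2) → Collision₃ f
collision₃-Fin2 f = collision₃-reflect lookup-eq (every-vector (f 0F) (f 1F) (f 2F) (f 3F) (f 4F))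
  where
  every-vector : ∀ a b c d e → Collision₃ (lookup (a ∷ b ∷ c ∷ d ∷ e ∷ []))
  every-vector = toWitness {a? = all? λ a → all? λ b → all? λ c → all? λ d → all? λ e →
                                   collision₃? (lookup (a ∷ b ∷ c ∷ d ∷ e ∷ []))} _
  lookup-eq : ∀ t t′ → lookup (tabulate f) t ≡ lookup (tabulate f) t′ → f t ≡ f t′
  lookup-eq t t′ e = trans (sym (lookup∘tabulate f t)) (trans e (lookup∘tabulate f t′))

distinct₃-exhaust : ∀ {k} → k ℕ.≤ 3 → {i j m : Fin k} → i ≢ j → i ≢ m → j ≢ m →
                    ∀ l → l ≡ i ⊎ l ≡ j ⊎ l ≡ m
distinct₃-exhaust k≤3 {i} {j} {m} i≢j i≢m j≢m l =
  Sum.map ι-injective (Sum.map ι-injective ι-injective)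
    (in-Fin3 (ι i) (ι j) (ι m) (ι l) (i≢j ∘ ι-injective) (i≢m ∘ ι-injective) (j≢m ∘ ι-injective))
  where
  ι : Fin _ → Fin 3
  ι x = inject≤ x k≤3
  ι-injective : ∀ {x y} → ι x ≡ ι y → x ≡ y
  ι-injective = inject≤-injective k≤3 k≤3 _ _
  in-Fin3 : ∀ (i j m l : Fin 3) → i ≢ j → i ≢ m → j ≢ m → l ≡ i ⊎ l ≡ j ⊎ l ≡ m
  in-Fin3 = toWitness {a? = all? λ i → all? λ j → all? λ m → all? λ l →
                         ¬? (i ≟ j) →-dec ¬? (i ≟ m) →-dec ¬? (j ≟ m) →-dec
                         (l ≟ i ⊎-dec l ≟ j ⊎-dec l ≟ m)} _

-- A missed value j lets f factor injectively through punchOut j into Fin 2.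
collision₃-free-onto : ∀ {k} → k ℕ.≤ 3 → (f : Fin 5 → Fin k) → ¬ Collision₃ f → ∀ j → ∃[ t ] f t ≡ j
collision₃-free-onto {suc k} (s≤s k≤2) f no-collision j with any? (λ t → f t ≟ j)
... | yes hit = hit
... | no miss = ⊥-elim (no-collision (collision₃-reflect same (collision₃-Fin2 g)))
  where
  j≢f : ∀ t → j ≢ f t
  j≢f t j≡ft = miss (t , sym j≡ft)
  g : Fin 5 → Fin 2
  g t = inject≤ (punchOut (j≢f t)) k≤2
  same : ∀ t t′ → g t ≡ g t′ → f t ≡ f t′
  same t t′ = punchOut-injective (j≢f t) (j≢f t′) ∘ inject≤-injective k≤2 k≤2 _ _

Adj : ∀ {n} → Graph n → Fin n → Fin n → Set
Adj G u v = T (G u v)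

Loopless : ∀ {n} → Graph n → Set
Loopless G = ∀ v → ¬ Adj G v v

K₄-free : ∀ {n} → Graph n → Set
K₄-free G = ∀ a b c d → Adj G a b → Adj G a c → Adj G a d → Adj G b c → Adj G b d → Adj G c d → ⊥

IsClique : ∀ {n} → Graph n → Pred (Fin n) 0ℓ → Set
IsClique G C = ∀ {u v} → u ≢ v → C u → C v → Adj G u v

Covers : ∀ {n} → Pred (Fin n) 0ℓ → Fin n → Fin n → Set
Covers C u v = C u × C v

record FiveNeighbours {n} (G : Graph n) (v : Fin n) : Set where
  field
    nbr : Fin 5 → Fin n
    nbr-adjacent : ∀ t → Adj G v (nbr t)
    nbr-injective : ∀ {t t′} → nbr t ≡ nbr t′ → t ≡ t′

record EdgeLink {n} (G : Graph n) (x y : Fin n) : Set where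
  field
    a b : Fin n
    a≢b : a ≢ b
    x∼a : Adj G x a
    y∼a : Adj G y a
    x∼b : Adj G x b
    y∼b : Adj G y b
    c d : Fin n
    c≢d : c ≢ d
    y∼c : Adj G y c
    x≁c : ¬ Adj G x c
    c≢x : c ≢ x
    y∼d : Adj G y d
    x≁d : ¬ Adj G x d
    d≢x : d ≢ x
    p q : Fin n
    p≢q : p ≢ q
    x∼p : Adj G x p
    y≁p : ¬ Adj G y p
    p≢y : p ≢ y
    x∼q : Adj G x q
    y≁q : ¬ Adj G y q
    q≢y : q ≢ y

adj? : ∀ {n} (G : Graph n) u v → Dec (Adj G u v)
adj? G u v = T? (G u v)

record IcosahedronLike {n} (G : Graph n) : Set where
  field
    loopless : Loopless G
    k₄-free : K₄-free G
    five-neighbours : ∀ v → FiveNeighbours G v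
    edge-link : ∀ {x y} → Adj G x y → EdgeLink G x y

_⇔?_ : ∀ {A B : Set} → Dec A → Dec B → Dec (A ⇔ B)
A? ⇔? B? = map′ (uncurry mk⇔) (λ A⇔B → Equivalence.to A⇔B , Equivalence.from A⇔B) ((A? →-dec B?) ×-dec (B? →-dec A?))

loopless? : ∀ {n} (G : Graph n) → Dec (Loopless G)
loopless? G = all? λ v → ¬? (adj? G v v)

K₄-free? : ∀ {n} (G : Graph n) → Dec (K₄-free G)
K₄-free? G = map′ (λ k₄-free′ a b c d ab ac ad bc bd cd → k₄-free′ a b ab c ac bc d ad bd cd)
                  (λ k₄-free a b ab c ac bc d ad bd cd → k₄-free a b c d ab ac ad bc bd cd)
                  (all? λ a → all? λ b → adj? G a b →-dec all? λ c → adj? G a c →-dec adj? G b c →-dec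
                   all? λ d → adj? G a d →-dec adj? G b d →-dec ¬? (adj? G c d))

TwoDistinct : ∀ {n} → Pred (Fin n) 0ℓ → Set
TwoDistinct P = ∃[ u ] ∃[ v ] (u ≢ v × P u × P v)

twoDistinct? : ∀ {n} {P : Pred (Fin n) 0ℓ} → Decidable₁ P → Dec (TwoDistinct P)
twoDistinct? P? = any? λ u → any? λ v → ¬? (u ≟ v) ×-dec P? u ×-dec P? v

LinkPairs : ∀ {n} → Graph n → Fin n → Fin n → Set
LinkPairs G x y = TwoDistinct (λ v → Adj G x v × Adj G y v)
                × TwoDistinct (λ v → Adj G y v × ¬ Adj G x v × v ≢ x)
                × TwoDistinct (λ v → Adj G x v × ¬ Adj G y v × v ≢ y)

linkPairs? : ∀ {n} (G : Graph n) x y → Dec (LinkPairs G x y)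
linkPairs? G x y = twoDistinct? (λ v → adj? G x v ×-dec adj? G y v)
            ×-dec twoDistinct? (λ v → adj? G y v ×-dec ¬? (adj? G x v) ×-dec ¬? (v ≟ x))
            ×-dec twoDistinct? (λ v → adj? G x v ×-dec ¬? (adj? G y v) ×-dec ¬? (v ≟ y))

linkPairs⇒EdgeLink : ∀ {n} {G : Graph n} {x y} → LinkPairs G x y → EdgeLink G x y
linkPairs⇒EdgeLink ((a , b , a≢b , (x∼a , y∼a) , (x∼b , y∼b)) ,
                    (c , d , c≢d , (y∼c , x≁c , c≢x) , (y∼d , x≁d , d≢x)) ,
                    (p , q , p≢q , (x∼p , y≁p , p≢y) , (x∼q , y≁q , q≢y))) = record
  { a = a ; b = b ; a≢b = a≢b ; x∼a = x∼a ; y∼a = y∼a ; x∼b = x∼b ; y∼b = y∼b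
  ; c = c ; d = d ; c≢d = c≢d ; y∼c = y∼c ; x≁c = x≁c ; c≢x = c≢x ; y∼d = y∼d ; x≁d = x≁d ; d≢x = d≢x
  ; p = p ; q = q ; p≢q = p≢q ; x∼p = x∼p ; y≁p = y≁p ; p≢y = p≢y ; x∼q = x∼q ; y≁q = y≁q ; q≢y = q≢y
  }

isCompetitionGraphOf? : ∀ {m} (G : Graph m) (D : Digraph m) → Dec (IsCompetitionGraphOf G D)
isCompetitionGraphOf? G D =
  all? λ x → all? λ y → ¬? (x ≟ y) →-dec (adj? G x y ⇔? any? λ v → T? (D x v) ×-dec T? (D y v))

-- Clique covers of stars

module IcosahedronLikeProperties {n} {G : Graph n} (I : IcosahedronLike G) where

  open IcosahedronLike I

  private
    V = Fin n

  adj⇒≢ : ∀ {u v} → Adj G u v → u ≢ v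
  adj⇒≢ {u} u∼v refl = loopless u u∼v

  separated : ∀ {w s t} → Adj G w s → ¬ Adj G w t → s ≢ t
  separated w∼s w≁t refl = w≁t w∼s

  no-four-in-clique : ∀ {C a b c d} → IsClique G C → C a → C b → C c → C d →
                      a ≢ b → a ≢ c → a ≢ d → b ≢ c → b ≢ d → c ≢ d → ⊥
  no-four-in-clique C-clique a∈ b∈ c∈ d∈ a≢b a≢c a≢d b≢c b≢d c≢d =
    k₄-free _ _ _ _ (C-clique a≢b a∈ b∈) (C-clique a≢c a∈ c∈) (C-clique a≢d a∈ d∈)
            (C-clique b≢c b∈ c∈) (C-clique b≢d b∈ d∈) (C-clique c≢d c∈ d∈)

  record Triangle (C : Pred V 0ℓ) (u v w : V) : Set where
    constructor triangle
    field
      u∈ : C u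
      v∈ : C v
      w∈ : C w
      u≢v : u ≢ v
      u≢w : u ≢ w
      v≢w : v ≢ w

  triangle-maximal : ∀ {C u v w t} → IsClique G C → Triangle C u v w → C t → t ≡ u ⊎ t ≡ v ⊎ t ≡ w
  triangle-maximal {t = t} C-clique (triangle u∈ v∈ w∈ u≢v u≢w v≢w) t∈
    with t ≟ _ | t ≟ _ | t ≟ _
  ... | yes t≡u | _       | _       = inj₁ t≡u
  ... | no _    | yes t≡v | _       = inj₂ (inj₁ t≡v)
  ... | no _    | no _    | yes t≡w = inj₂ (inj₂ t≡w)
  ... | no t≢u  | no t≢v  | no t≢w  = ⊥-elim (no-four-in-clique C-clique t∈ u∈ v∈ w∈ t≢u t≢v t≢w u≢v u≢w v≢w)

  ∉-triangle : ∀ {C u v w t} → IsClique G C → Triangle C u v w → t ≢ u → t ≢ v → t ≢ w → ¬ C t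
  ∉-triangle C-clique tri t≢u t≢v t≢w t∈ = Sum.[ t≢u , Sum.[ t≢v , t≢w ] ] (triangle-maximal C-clique tri t∈)

  nbr : V → Fin 5 → V
  nbr v = FiveNeighbours.nbr (five-neighbours v)

  nbr-adjacent : ∀ v t → Adj G v (nbr v t)
  nbr-adjacent v = FiveNeighbours.nbr-adjacent (five-neighbours v)

  nbr-injective : ∀ v {t t′} → nbr v t ≡ nbr v t′ → t ≡ t′
  nbr-injective v = FiveNeighbours.nbr-injective (five-neighbours v)

  nbr-≢-centre : ∀ v t → nbr v t ≢ v
  nbr-≢-centre v t = adj⇒≢ (nbr-adjacent v t) ∘ sym

  star-cover-collision-free : ∀ {Ix : Set} {v} (K : Ix → Pred V 0ℓ) → (∀ s → IsClique G (K s)) →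
                              (cover : ∀ t → ∃[ s ] Covers (K s) v (nbr v t)) → ¬ Collision₃ (proj₁ ∘ cover)
  star-cover-collision-free {Ix} {v} K K-clique cover (t₁ , t₂ , t₃ , t₁<t₂ , t₂<t₃ , s₁≡s₂ , s₂≡s₃) =
    no-four-in-clique (K-clique s₁) v∈ (proj₂ (proj₂ (cover t₁))) (in-K₁ s₁≡s₂) (in-K₁ (trans s₁≡s₂ s₂≡s₃))
      (adj⇒≢ (nbr-adjacent v t₁)) (adj⇒≢ (nbr-adjacent v t₂)) (adj⇒≢ (nbr-adjacent v t₃))
      (nbr-≢ (<⇒≢ t₁<t₂)) (nbr-≢ (<⇒≢ (<-trans t₁<t₂ t₂<t₃))) (nbr-≢ (<⇒≢ t₂<t₃))
    where
    s₁ : Ix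
    s₁ = proj₁ (cover t₁)
    v∈ : K s₁ v
    v∈ = proj₁ (proj₂ (cover t₁))
    in-K₁ : ∀ {t} → s₁ ≡ proj₁ (cover t) → K s₁ (nbr v t)
    in-K₁ {t} e = subst (λ s → K s (nbr v t)) (sym e) (proj₂ (proj₂ (cover t)))
    nbr-≢ : ∀ {t t′} → t ≢ t′ → nbr v t ≢ nbr v t′
    nbr-≢ t≢t′ = t≢t′ ∘ nbr-injective v

  no-two-clique-star-cover : ∀ {v C D} → IsClique G C → IsClique G D →
                             (∀ t → Covers C v (nbr v t) ⊎ Covers D v (nbr v t)) → ⊥
  no-two-clique-star-cover {v} {C} {D} C-clique D-clique cover =
    star-cover-collision-free K K-clique indexed (collision₃-Fin2 (proj₁ ∘ indexed))
    where
    K : Fin 2 → Pred V 0ℓ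
    K = lookup (C ∷ D ∷ [])
    K-clique : ∀ s → IsClique G (K s)
    K-clique 0F = C-clique
    K-clique 1F = D-clique
    indexed : ∀ t → ∃[ s ] Covers (K s) v (nbr v t)
    indexed t with cover t
    ... | inj₁ C-covers = 0F , C-covers
    ... | inj₂ D-covers = 1F , D-covers

  star-cover-≤3-through-centre : ∀ {k v} → k ℕ.≤ 3 → (A : Fin k → Pred V 0ℓ) → (∀ j → IsClique G (A j)) →
                                 (∀ u → Adj G v u → ∃[ j ] Covers (A j) v u) → ∀ j → A j v
  star-cover-≤3-through-centre {v = v} k≤3 A A-clique cover j =
    centre-in (collision₃-free-onto k≤3 (proj₁ ∘ cover′) (star-cover-collision-free A A-clique cover′) j)
    where
    cover′ : ∀ t → ∃[ j ] Covers (A j) v (nbr v t)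
    cover′ t = cover (nbr v t) (nbr-adjacent v t)
    centre-in : ∃[ t ] proj₁ (cover′ t) ≡ j → A j v
    centre-in (t , refl) = proj₁ (proj₂ (cover′ t))

  module LayeredStarCover
    {k} (k≤3 : k ℕ.≤ 3) (A : Fin k → Pred V 0ℓ) (Bx By : Pred V 0ℓ)
    (A-clique : ∀ j → IsClique G (A j)) (Bx-clique : IsClique G Bx) (By-clique : IsClique G By)
    {x y z : V} (x≢y : x ≢ y) (z≢x : z ≢ x) (z≢y : z ≢ y)
    (star-x : ∀ c → Adj G x c → ∃[ j ] Covers (A j) x c)
    (star-y : ∀ c → Adj G y c → (∃[ j ] Covers (A j) y c) ⊎ Covers Bx y c)
    (star-z : ∀ c → Adj G z c → (∃[ j ] Covers (A j) z c) ⊎ Covers Bx z c ⊎ Covers By z c)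
    where

    x∈A : ∀ j → A j x
    x∈A = star-cover-≤3-through-centre k≤3 A A-clique star-x

    module Adjacent (x∼y : Adj G x y) where

      open EdgeLink (edge-link x∼y)

      y-private-covered : ∀ {c′} → Adj G y c′ → ¬ Adj G x c′ → c′ ≢ x → Covers Bx y c′
      y-private-covered {c′} y∼c′ x≁c′ c′≢x with star-y c′ y∼c′
      ... | inj₁ (j , _ , c′∈Aⱼ) = ⊥-elim (x≁c′ (A-clique j (c′≢x ∘ sym) (x∈A j) c′∈Aⱼ))
      ... | inj₂ Bx-covers = Bx-covers

      Bx-triangle : Triangle Bx y c d
      Bx-triangle = triangle (proj₁ (y-private-covered y∼c x≁c c≢x)) (proj₂ (y-private-covered y∼c x≁c c≢x))
                             (proj₂ (y-private-covered y∼d x≁d d≢x)) (adj⇒≢ y∼c) (adj⇒≢ y∼d) c≢d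

      common-covered : ∀ {a′} → Adj G x a′ → Adj G y a′ → ∃[ i ] Covers (A i) y a′
      common-covered x∼a′ y∼a′ with star-y _ y∼a′
      ... | inj₁ A-covers = A-covers
      ... | inj₂ (_ , a′∈Bx) =
        ⊥-elim (∉-triangle Bx-clique Bx-triangle (adj⇒≢ y∼a′ ∘ sym) (separated x∼a′ x≁c) (separated x∼a′ x≁d)
                           a′∈Bx)

      through-xy : ∀ {a′} → Adj G x a′ → Adj G y a′ → ∃[ i ] Triangle (A i) x y a′
      through-xy x∼a′ y∼a′ with common-covered x∼a′ y∼a′
      ... | i , y∈ , a′∈ = i , triangle (x∈A i) y∈ a′∈ x≢y (adj⇒≢ x∼a′) (adj⇒≢ y∼a′)

      i j : Fin k
      i = proj₁ (through-xy x∼a y∼a)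
      j = proj₁ (through-xy x∼b y∼b)

      Aᵢ-triangle : Triangle (A i) x y a
      Aᵢ-triangle = proj₂ (through-xy x∼a y∼a)

      Aⱼ-triangle : Triangle (A j) x y b
      Aⱼ-triangle = proj₂ (through-xy x∼b y∼b)

      i≢j : i ≢ j
      i≢j i≡j = ∉-triangle (A-clique i) Aᵢ-triangle (adj⇒≢ x∼b ∘ sym) (adj⇒≢ y∼b ∘ sym) (a≢b ∘ sym)
                  (subst (λ l → A l b) (sym i≡j) (Triangle.w∈ Aⱼ-triangle))

      x-private-covered : ∀ {p′} → Adj G x p′ → ¬ Adj G y p′ → p′ ≢ y → ∃[ m ] (A m p′ × i ≢ m × j ≢ m)
      x-private-covered {p′} x∼p′ y≁p′ p′≢y with star-x p′ x∼p′
      ... | m , _ , p′∈Aₘ = m , p′∈Aₘ , avoids Aᵢ-triangle y∼a , avoids Aⱼ-triangle y∼b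
        where
        avoids : ∀ {l u} → Triangle (A l) x y u → Adj G y u → l ≢ m
        avoids {l} tri y∼u l≡m = ∉-triangle (A-clique l) tri (adj⇒≢ x∼p′ ∘ sym) p′≢y (separated y∼u y≁p′ ∘ sym)
                                   (subst (λ l → A l p′) (sym l≡m) p′∈Aₘ)

      m : Fin k
      m = proj₁ (x-private-covered x∼p y≁p p≢y)

      i≢m : i ≢ m
      i≢m = proj₁ (proj₂ (proj₂ (x-private-covered x∼p y≁p p≢y)))

      j≢m : j ≢ m
      j≢m = proj₂ (proj₂ (proj₂ (x-private-covered x∼p y≁p p≢y)))

      q∈Aₘ : A m q
      q∈Aₘ with x-private-covered x∼q y≁q q≢y
      ... | m′ , q∈Aₘ′ , i≢m′ , j≢m′ with distinct₃-exhaust k≤3 i≢j i≢m j≢m m′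
      ... | inj₁ m′≡i = ⊥-elim (i≢m′ (sym m′≡i))
      ... | inj₂ (inj₁ m′≡j) = ⊥-elim (j≢m′ (sym m′≡j))
      ... | inj₂ (inj₂ m′≡m) = subst (λ l → A l q) m′≡m q∈Aₘ′

      Aₘ-triangle : Triangle (A m) x p q
      Aₘ-triangle = triangle (x∈A m) (proj₁ (proj₂ (x-private-covered x∼p y≁p p≢y))) q∈Aₘ
                             (adj⇒≢ x∼p) (adj⇒≢ x∼q) p≢q

      L : Fin 4 → Pred V 0ℓ
      L = lookup (A i ∷ A j ∷ A m ∷ Bx ∷ [])

      L-clique : ∀ ℓ → IsClique G (L ℓ)
      L-clique 0F = A-clique i
      L-clique 1F = A-clique j
      L-clique 2F = A-clique m
      L-clique 3F = Bx-clique

      -- the index of the only triangle L ℓ that can contain a vertex outside {x, y}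
      slot : V → Fin 4
      slot t = if does (t ≟ a) then 0F else if does (t ≟ b) then 1F else if G x t then 2F else 3F

      slot-a : slot a ≡ 0F
      slot-a rewrite dec-true (a ≟ a) refl = refl

      slot-b : slot b ≡ 1F
      slot-b rewrite dec-false (b ≟ a) (a≢b ∘ sym) | dec-true (b ≟ b) refl = refl

      slot-x-private : ∀ {t} → Adj G x t → ¬ Adj G y t → slot t ≡ 2F
      slot-x-private {t} x∼t y≁t
        rewrite dec-false (t ≟ a) (separated y∼a y≁t ∘ sym) | dec-false (t ≟ b) (separated y∼b y≁t ∘ sym)
              | dec-true (T? (G x t)) x∼t = refl

      slot-y-private : ∀ {t} → ¬ Adj G x t → slot t ≡ 3F
      slot-y-private {t} x≁t
        rewrite dec-false (t ≟ a) (separated x∼a x≁t ∘ sym) | dec-false (t ≟ b) (separated x∼b x≁t ∘ sym)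
              | dec-false (T? (G x t)) x≁t = refl

      slot-correct : ∀ ℓ {t} → L ℓ t → t ≢ x → t ≢ y → slot t ≡ ℓ
      slot-correct 0F t∈ t≢x t≢y with triangle-maximal (A-clique i) Aᵢ-triangle t∈
      ... | inj₁ t≡x = ⊥-elim (t≢x t≡x)
      ... | inj₂ (inj₁ t≡y) = ⊥-elim (t≢y t≡y)
      ... | inj₂ (inj₂ refl) = slot-a
      slot-correct 1F t∈ t≢x t≢y with triangle-maximal (A-clique j) Aⱼ-triangle t∈
      ... | inj₁ t≡x = ⊥-elim (t≢x t≡x)
      ... | inj₂ (inj₁ t≡y) = ⊥-elim (t≢y t≡y)
      ... | inj₂ (inj₂ refl) = slot-b
      slot-correct 2F t∈ t≢x t≢y with triangle-maximal (A-clique m) Aₘ-triangle t∈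
      ... | inj₁ t≡x = ⊥-elim (t≢x t≡x)
      ... | inj₂ (inj₁ refl) = slot-x-private x∼p y≁p
      ... | inj₂ (inj₂ refl) = slot-x-private x∼q y≁q
      slot-correct 3F t∈ t≢x t≢y with triangle-maximal Bx-clique Bx-triangle t∈
      ... | inj₁ t≡y = ⊥-elim (t≢y t≡y)
      ... | inj₂ (inj₁ refl) = slot-y-private x≁c
      ... | inj₂ (inj₂ refl) = slot-y-private x≁d

      via-slot : ∀ ℓ {r} → Covers (L ℓ) z r → Covers (L (slot z)) z r
      via-slot ℓ L-covers = subst (λ ℓ′ → Covers (L ℓ′) z _) (sym (slot-correct ℓ (proj₁ L-covers) z≢x z≢y)) L-covers

      z-star : ∀ t → Covers (L (slot z)) z (nbr z t) ⊎ Covers By z (nbr z t)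
      z-star t with star-z (nbr z t) (nbr-adjacent z t)
      ... | inj₂ (inj₂ By-covers) = inj₂ By-covers
      ... | inj₂ (inj₁ Bx-covers) = inj₁ (via-slot 3F Bx-covers)
      ... | inj₁ (l , A-covers) with distinct₃-exhaust k≤3 i≢j i≢m j≢m l
      ...   | inj₁ l≡i = inj₁ (via-slot 0F (subst (λ l → Covers (A l) z _) l≡i A-covers))
      ...   | inj₂ (inj₁ l≡j) = inj₁ (via-slot 1F (subst (λ l → Covers (A l) z _) l≡j A-covers))
      ...   | inj₂ (inj₂ l≡m) = inj₁ (via-slot 2F (subst (λ l → Covers (A l) z _) l≡m A-covers))

      impossible : ⊥
      impossible = no-two-clique-star-cover (L-clique (slot z)) By-clique z-star

    impossible : ⊥
    impossible with T? (G x y)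
    ... | yes x∼y = Adjacent.impossible x∼y
    ... | no x≁y = no-two-clique-star-cover Bx-clique Bx-clique (inj₁ ∘ y-star-in-Bx)
      where
      y-star-in-Bx : ∀ t → Covers Bx y (nbr y t)
      y-star-in-Bx t with star-y (nbr y t) (nbr-adjacent y t)
      ... | inj₁ (j , y∈Aⱼ , _) = ⊥-elim (x≁y (A-clique j x≢y (x∈A j) y∈Aⱼ))
      ... | inj₂ Bx-covers = Bx-covers

-- Acyclic digraphs

TransClosure-map : ∀ {A B : Set} {R : Rel A 0ℓ} {S : Rel B 0ℓ} (f : A → B) →
                   (∀ {u v} → R u v → S (f u) (f v)) → ∀ {u v} → TransClosure R u v → TransClosure S (f u) (f v)
TransClosure-map f R⇒S [ uRv ] = [ R⇒S uRv ]
TransClosure-map f R⇒S (uRw ∷ w⁺v) = R⇒S uRw ∷ TransClosure-map f R⇒S w⁺v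

module _ {m} (R : Rel (Fin m) 0ℓ) {P : Pred (Fin m) 0ℓ} (successor : ∀ s → P s → ∃[ w ] (P w × R s w))
         {v₀} (P[v₀] : P v₀) where

  private
    walk : ℕ → Σ (Fin m) P
    walk zero = v₀ , P[v₀]
    walk (suc i) with successor (proj₁ (walk i)) (proj₂ (walk i))
    ... | w , P[w] , _ = w , P[w]

    position : ℕ → Fin m
    position = proj₁ ∘ walk

    walk-step : ∀ i → R (position i) (position (suc i))
    walk-step i with successor (proj₁ (walk i)) (proj₂ (walk i))
    ... | _ , _ , sRw = sRw

    walk-path : ∀ {i j} → suc i ≤′ j → TransClosure R (position i) (position j)
    walk-path {i} (≤′-reflexive refl) = [ walk-step i ]
    walk-path (≤′-step {j} i<j) = walk-path i<j ∷ʳ walk-step j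

  successor-closed⇒cycle : ∃[ v ] TransClosure R v v
  successor-closed⇒cycle with pigeonhole (ℕₚ.n<1+n m) (position ∘ toℕ)
  ... | i , j , i<j , same = position (toℕ i) , subst (TransClosure R _) (sym same) (walk-path (ℕₚ.≤⇒≤′ i<j))

acyclic-sink : ∀ {m} (R : Rel (Fin m) 0ℓ) → Decidable R → (∀ v → ¬ TransClosure R v v) →
               (P : Pred (Fin m) 0ℓ) → Decidable₁ P → ∀ {v₀} → P v₀ → ∃[ s ] (P s × ∀ w → P w → ¬ R s w)
acyclic-sink R R? R-acyclic P P? P[v₀] with any? (λ s → P? s ×-dec ¬? (any? λ w → P? w ×-dec R? s w))
... | yes (s , P[s] , no-successor) = s , P[s] , λ w P[w] sRw → no-successor (w , P[w] , sRw)
... | no no-sink = ⊥-elim (R-acyclic _ (proj₂ (successor-closed⇒cycle R successor P[v₀])))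
  where
  successor : ∀ s → P s → ∃[ w ] (P w × R s w)
  successor s P[s] = decidable-stable (any? λ w → P? w ×-dec R? s w) (λ none → no-sink (s , P[s] , none))

ranked⇒acyclic : ∀ {m} (D : Digraph m) (rank : Fin m → ℕ) → (∀ v w → Arc D v w → rank v ℕ.< rank w) → Acyclic D
ranked⇒acyclic D rank arc-rises v cycle = ℕₚ.<-irrefl refl (rises cycle)
  where
  rises : ∀ {u w} → TransClosure (Arc D) u w → rank u ℕ.< rank w
  rises [ u→w ] = arc-rises _ _ u→w
  rises (u→v ∷ v→⁺w) = ℕₚ.<-trans (arc-rises _ _ u→v) (rises v→⁺w)

-- Competition graphs

module CompetitionGraph {n k} (G : Graph n) (D : Digraph (n + k))
                        (D-competition : IsCompetitionGraphOf (addIsolated G k) D) where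

  orig : Fin n → Fin (n + k)
  orig = _↑ˡ k

  extra : Fin k → Fin (n + k)
  extra = n ↑ʳ_

  orig-or-extra : ∀ w → (∃[ i ] w ≡ orig i) ⊎ (∃[ j ] w ≡ extra j)
  orig-or-extra w with splitAt n w in split
  ... | inj₁ i = inj₁ (i , sym (splitAt⁻¹-↑ˡ split))
  ... | inj₂ j = inj₂ (j , sym (splitAt⁻¹-↑ʳ split))

  Predators : Fin (n + k) → Pred (Fin n) 0ℓ
  Predators w c = Arc D (orig c) w

  addIsolated-orig : ∀ u v → addIsolated G k (orig u) (orig v) ≡ G u v
  addIsolated-orig u v rewrite splitAt-↑ˡ n u k | splitAt-↑ˡ n v k = refl

  orig-≢ : ∀ {u v} → u ≢ v → orig u ≢ orig v
  orig-≢ u≢v = u≢v ∘ ↑ˡ-injective k _ _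

  predators-clique : ∀ w → IsClique G (Predators w)
  predators-clique w {u} {v} u≢v u→w v→w =
    subst T (addIsolated-orig u v) (Equivalence.from (D-competition (orig u) (orig v) (orig-≢ u≢v)) (w , u→w , v→w))

  edge-has-prey : ∀ {u v} → u ≢ v → Adj G u v → ∃[ w ] Covers (Predators w) u v
  edge-has-prey {u} {v} u≢v u∼v =
    Equivalence.to (D-competition (orig u) (orig v) (orig-≢ u≢v)) (subst T (sym (addIsolated-orig u v)) u∼v)

module LowerBound {n k} {G : Graph (suc n)} (I : IcosahedronLike G) (k≤3 : k ℕ.≤ 3) (D : Digraph (suc n + k))
                  (D-acyclic : Acyclic D) (D-competition : IsCompetitionGraphOf (addIsolated G k) D) where

  open CompetitionGraph G D D-competition
  open IcosahedronLikeProperties I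

  private
    V = Fin (suc n)

  Arcᵒ : Rel V 0ℓ
  Arcᵒ u v = Arc D (orig u) (orig v)

  sink : (P : Pred V 0ℓ) → Decidable₁ P → ∀ {v₀} → P v₀ → ∃[ s ] (P s × ∀ c → P c → ¬ Arcᵒ s c)
  sink = acyclic-sink Arcᵒ (λ u v → T? _) (λ v → D-acyclic (orig v) ∘ TransClosure-map orig (λ u→v → u→v))

  prey-of-sink : ∀ {x} → (∀ c → ¬ Arcᵒ x c) → ∀ c → Adj G x c → ∃[ j ] Covers (Predators (extra j)) x c
  prey-of-sink x-sink c x∼c with edge-has-prey (adj⇒≢ x∼c) x∼c
  ... | w , covers with orig-or-extra w
  ... | inj₁ (i , refl) = ⊥-elim (x-sink i (proj₁ covers))
  ... | inj₂ (j , refl) = j , covers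

  prey-of-second-sink : ∀ {x y} → (∀ c → c ≢ x → ¬ Arcᵒ y c) → ∀ c → Adj G y c →
                        (∃[ j ] Covers (Predators (extra j)) y c) ⊎ Covers (Predators (orig x)) y c
  prey-of-second-sink {x} y-sink c y∼c with edge-has-prey (adj⇒≢ y∼c) y∼c
  ... | w , covers with orig-or-extra w
  ... | inj₂ (j , refl) = inj₁ (j , covers)
  ... | inj₁ (i , refl) with i ≟ x
  ...   | yes refl = inj₂ covers
  ...   | no i≢x = ⊥-elim (y-sink i i≢x (proj₁ covers))

  prey-of-third-sink : ∀ {x y z} → (∀ c → c ≢ x × c ≢ y → ¬ Arcᵒ z c) → ∀ c → Adj G z c →
                       (∃[ j ] Covers (Predators (extra j)) z c) ⊎ Covers (Predators (orig x)) z c ⊎ Covers (Predators (orig y)) z c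
  prey-of-third-sink {x} {y} z-sink c z∼c with edge-has-prey (adj⇒≢ z∼c) z∼c
  ... | w , covers with orig-or-extra w
  ... | inj₂ (j , refl) = inj₁ (j , covers)
  ... | inj₁ (i , refl) with i ≟ x | i ≟ y
  ...   | yes refl | _ = inj₂ (inj₁ covers)
  ...   | no _ | yes refl = inj₂ (inj₂ covers)
  ...   | no i≢x | no i≢y = ⊥-elim (z-sink i (i≢x , i≢y) (proj₁ covers))

  avoiding-two : ∀ x y → ∃[ c ] (c ≢ x × c ≢ y)
  avoiding-two x y with nbr x 0F ≟ y
  ... | no n₀≢y = nbr x 0F , nbr-≢-centre x 0F , n₀≢y
  ... | yes n₀≡y = nbr x 1F , nbr-≢-centre x 1F , λ n₁≡y → 0≢1 (nbr-injective x (trans n₀≡y (sym n₁≡y)))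
    where
    0≢1 : 0F ≢ 1F
    0≢1 ()

  impossible : ⊥
  impossible with sink (λ _ → ⊤) (λ _ → yes tt) {0F} tt
  ... | x , _ , x-sink with sink (_≢ x) (λ c → ¬? (c ≟ x)) (nbr-≢-centre x 0F)
  ... | y , y≢x , y-sink with sink (λ c → c ≢ x × c ≢ y) (λ c → ¬? (c ≟ x) ×-dec ¬? (c ≟ y)) (proj₂ (avoiding-two x y))
  ... | z , (z≢x , z≢y) , z-sink =
    LayeredStarCover.impossible k≤3 (Predators ∘ extra) (Predators (orig x)) (Predators (orig y))
      (predators-clique ∘ extra) (predators-clique (orig x)) (predators-clique (orig y)) (y≢x ∘ sym) z≢x z≢y
      (prey-of-sink (λ c → x-sink c tt)) (prey-of-second-sink y-sink) (prey-of-third-sink (λ c → z-sink c))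

competition-number-≥4 : ∀ {n} {G : Graph (suc n)} → IcosahedronLike G → ∀ k → CompetitionRepresentable G k → 4 ℕ.≤ k
competition-number-≥4 I k (D , D-acyclic , D-competition) =
  ℕₚ.≰⇒> (λ k≤3 → LowerBound.impossible I k≤3 D D-acyclic D-competition)

-- The icosahedron

neighbourTable : ℕ → Vec (Fin 12) 5
neighbourTable 0 = # 1 ∷ # 2 ∷ # 3 ∷ # 4 ∷ # 5 ∷ []
neighbourTable 1 = # 0 ∷ # 2 ∷ # 5 ∷ # 6 ∷ # 7 ∷ []
neighbourTable 2 = # 0 ∷ # 1 ∷ # 3 ∷ # 7 ∷ # 8 ∷ []
neighbourTable 3 = # 0 ∷ # 2 ∷ # 4 ∷ # 8 ∷ # 9 ∷ []
neighbourTable 4 = # 0 ∷ # 3 ∷ # 5 ∷ # 9 ∷ # 10 ∷ []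
neighbourTable 5 = # 0 ∷ # 1 ∷ # 4 ∷ # 6 ∷ # 10 ∷ []
neighbourTable 6 = # 1 ∷ # 5 ∷ # 7 ∷ # 10 ∷ # 11 ∷ []
neighbourTable 7 = # 1 ∷ # 2 ∷ # 6 ∷ # 8 ∷ # 11 ∷ []
neighbourTable 8 = # 2 ∷ # 3 ∷ # 7 ∷ # 9 ∷ # 11 ∷ []
neighbourTable 9 = # 3 ∷ # 4 ∷ # 8 ∷ # 10 ∷ # 11 ∷ []
neighbourTable 10 = # 4 ∷ # 5 ∷ # 6 ∷ # 9 ∷ # 11 ∷ []
neighbourTable _ = # 6 ∷ # 7 ∷ # 8 ∷ # 9 ∷ # 10 ∷ []

icosahedron-neighbours : Fin 12 → Fin 5 → Fin 12
icosahedron-neighbours v = lookup (neighbourTable (toℕ v))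

icosahedron-five-neighbours : ∀ v → FiveNeighbours icosahedron v
icosahedron-five-neighbours v = record
  { nbr = icosahedron-neighbours v
  ; nbr-adjacent = toWitness {a? = all? λ v → all? λ t → adj? icosahedron v (icosahedron-neighbours v t)} _ v
  ; nbr-injective = toWitness {a? = all? λ v → all? λ t → all? λ t′ →
                                      icosahedron-neighbours v t ≟ icosahedron-neighbours v t′ →-dec t ≟ t′} _ v _ _
  }

icosahedron-like : IcosahedronLike icosahedron
icosahedron-like = record
  { loopless = toWitness {a? = loopless? icosahedron} _
  ; k₄-free = toWitness {a? = K₄-free? icosahedron} _
  ; five-neighbours = icosahedron-five-neighbours
  ; edge-link = λ {x} {y} x∼y → linkPairs⇒EdgeLink (link-pairs x y x∼y)
  }
  where
  link-pairs : ∀ x y → Adj icosahedron x y → LinkPairs icosahedron x y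
  link-pairs = toWitness {a? = all? λ x → all? λ y → adj? icosahedron x y →-dec linkPairs? icosahedron x y} _

-- The predators of each vertex of the witnessing digraph; 12–15 are the added isolated vertices.
predators : ℕ → List ℕ
predators 0 = 1 ∷ 5 ∷ 6 ∷ []
predators 1 = 6 ∷ 10 ∷ 11 ∷ []
predators 2 = 8 ∷ 9 ∷ 11 ∷ []
predators 4 = 2 ∷ 3 ∷ 8 ∷ []
predators 5 = 4 ∷ 9 ∷ 10 ∷ []
predators 6 = 4 ∷ 5 ∷ 10 ∷ []
predators 7 = 3 ∷ 9 ∷ []
predators 8 = 7 ∷ 11 ∷ []
predators 10 = 2 ∷ 7 ∷ 8 ∷ []
predators 12 = 0 ∷ 1 ∷ 2 ∷ []
predators 13 = 0 ∷ 3 ∷ 4 ∷ []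
predators 14 = 0 ∷ 1 ∷ 5 ∷ []
predators 15 = 1 ∷ 6 ∷ 7 ∷ []
predators _ = []

icosahedron-digraph : Digraph 16
icosahedron-digraph v w = any (toℕ v ≡ᵇ_) (predators (toℕ w))

level : ℕ → ℕ
level 11 = 0
level 9 = 1
level 3 = 2
level 7 = 3
level 8 = 4
level 2 = 5
level 4 = 6
level 10 = 7
level 5 = 8
level 6 = 9
level 1 = 10
level 0 = 11
level _ = 12

icosahedron-representable-with-4 : CompetitionRepresentable icosahedron 4
icosahedron-representable-with-4 =
  icosahedron-digraph ,
  ranked⇒acyclic icosahedron-digraph (level ∘ toℕ)
    (toWitness {a? = all? λ v → all? λ w → T? (icosahedron-digraph v w) →-dec level (toℕ v) ℕₚ.<? level (toℕ w)} _) ,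
  toWitness {a? = isCompetitionGraphOf? (addIsolated icosahedron 4) icosahedron-digraph} _

theorem2p5 : CompetitionNumberIs icosahedron 4
theorem2p5 = icosahedron-representable-with-4 , competition-number-≥4 icosahedron-like
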